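{- Let $p$ be an odd prime and $n,m$ positive integers coprime to $p$. Then $S(m,np;p)\equiv nm^2B_{p-3}\pmod{p}$.
   Context: For positive integers $m,N$ and an odd prime $p$, $S(m,N;p):=\sum_{\substack{a=1\\(a,p)=1}}^{N-1}\frac{1}{a^2}\sum_{\substack{i=1\\(i,p)=1}}^{am-1}\frac{1}{i}$. $B_k$ is the $k$-th Bernoulli number. Congruences of rationals with denominators coprime to $p$ are taken in the ring of such rationals. -}

module Defs where

open import Data.Nat as ℕ using (ℕ; zero; suc; NonZero)
open import Data.Nat.Divisibility using (_∣_; _∣?_)
import Data.Nat.Properties as ℕP
open import Data.Nat.Combinatorics using (_C_)
open import Data.Integer as ℤ using (ℤ; +_)
open import Data.Rational as ℚ using (ℚ; 0ℚ; 1ℚ; _+_; _*_; _-_; -_; ↥_; ↧ₙ_)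
open import Data.Bool using (Bool; true; false; if_then_else_)
open import Relation.Nullary.Decidable using (⌊_⌋)

sumFrom1 : ℕ → (ℕ → ℚ) → ℚ
sumFrom1 zero    f = 0ℚ
sumFrom1 (suc n) f = sumFrom1 n f + f (suc n)

coprimeTo : ℕ → ℕ → Bool
coprimeTo p a = if ⌊ p ∣? a ⌋ then false else true

-- 1 / i^k as a rational (value 0 for i = 0, never used)
inv : ℕ → ℕ → ℚ
inv zero    k = 0ℚ
inv (suc i) k = (+ 1) ℚ./ (suc i ℕ.^ k)
  where instance _ = ℕ.>-nonZero (ℕP.m^n>0 (suc i) k)

sumCop : ℕ → ℕ → (ℕ → ℚ) → ℚ
sumCop p n f = sumFrom1 n (λ i → if coprimeTo p i then f i else 0ℚ)

S : ℕ → ℕ → ℕ → ℚ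
S m N p = sumCop p (N ℕ.∸ 1) (λ a → inv a 2 * sumCop p (a ℕ.* m ℕ.∸ 1) (λ i → inv i 1))

-- Bernoulli numbers (convention B₁ = -1/2), via
-- B₀ = 1,  B_k = -(1/(k+1)) Σ_{j=0}^{k-1} C(k+1,j) B_j.
-- bernList k = [B_k, B_{k-1}, ..., B_0]
open import Data.List using (List; []; _∷_; length; reverse; zip; foldr; upTo)

private
  step : List ℚ → ℚ
  step bs = - ((+ 1 ℚ./ (suc k)) * foldr _+_ 0ℚ (go 0 (reverse bs)))
    where
      k = length bs
      go : ℕ → List ℚ → List ℚ
      go j []       = []
      go j (b ∷ bs) = (((+ (suc k C j)) ℚ./ 1) * b) ∷ go (suc j) bs

bernList : ℕ → List ℚ
bernList zero    = 1ℚ ∷ []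
bernList (suc k) = step (bernList k) ∷ bernList k

B : ℕ → ℚ
B k with bernList k
... | b ∷ _ = b
... | []    = 0ℚ

-- congruence of rationals modulo p: x - y lies in p·Z_(p),
-- i.e. the reduced difference has numerator divisible by p and denominator prime to p
_≡_[modℚ_] : ℚ → ℚ → ℕ → Set
x ≡ y [modℚ p ] = (p ∣ ℤ.∣ ↥ (x - y) ∣) Data.Product.× (Relation.Nullary.¬ (p ∣ ↧ₙ (x - y)))
  where import Data.Product; import Relation.Nullary

{-# OPTIONS --safe #-}
-- Reduction modulo p sends a p-integral rational x to residue x = ↥ x · (↧ x)^(p−2); by Fermat's
-- little theorem this is a ring map onto ℤ/p, and rationals with equal residues are congruent
-- modulo p. So 1/i reduces to i^(p−2), and the Bernoulli recursion shows that B₀, …, B_(p−2) are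
-- p-integral with Σ_{j<N} C(N,j) B_j ≡ [N = 1] for N < p. Telescoping gives Faulhaber's formula
-- (s+2) Σ_{i<k} i^(s+1) ≡ Σ_{j<s+2} C(s+2,j) B_j k^(s+2−j) for s ≤ p−3, which turns the inner sum
-- Σ_{i<am, p∤i} 1/i ≡ Σ_{i<am} i^(p−2) into a polynomial in am. Multiplying by a^(2(p−2)) and summing
-- over a < np, the power sums Σ_{a<np} a^e vanish modulo p unless p−1 divides e; only the term of
-- B_(p−3) survives, with coefficient n m² C(p−1,2) ≡ n m².
module Submission where

open import Data.Bool using (if_then_else_)
open import Data.Empty using (⊥-elim)
open import Data.Sum using (_⊎_; inj₁; inj₂)
open import Data.Integer as ℤ using (ℤ; +_; 0ℤ; 1ℤ)
import Data.Integer.Properties as ℤP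
open import Data.Integer.Tactic.RingSolver using (solve-∀)
open import Data.List using (List; []; _∷_; length; reverse; foldr; applyUpTo; _∷ʳ_)
import Data.List.Properties as ListP
open import Data.Product using (_,_)
open import Data.Rational as ℚ using (ℚ; ↥_; ↧_; ↧ₙ_; 0ℚ; 1ℚ)
import Data.Rational.Properties as ℚP
open import Data.Nat as ℕ using (ℕ; zero; suc; z≤n; s≤s; _!)
import Data.Nat.Divisibility as ℕD
open import Data.Nat.Primality using (Prime; euclidsLemma; prime⇒nonZero; prime⇒nonTrivial; ¬prime[0]; ¬prime[1])
open import Data.Nat.Combinatorics
  using (_C_; nCk+nC[k+1]≡[n+1]C[k+1]; nCn≡1; nC1≡n; k>n⇒nCk≡0; nCk≡nC[n∸k]; nCk≡n!/k![n-k]!; k![n∸k]!∣n!)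
import Data.Nat.DivMod as ℕDM
import Data.Nat.Properties as ℕP
import Data.Nat.Tactic.RingSolver as ℕSolver
open import Function using (_∘_)
open import Relation.Binary.PropositionalEquality
open import Relation.Nullary using (yes; no; ¬_)
open import Relation.Nullary.Decidable using (⌊_⌋)

module _ where
  open import Data.Nat using (_+_; _*_; _∸_; _≤_; _<_)

  nCk*k!*[n∸k]!≡n! : ∀ {n k} → k ≤ n → (n C k) * (k ! * (n ∸ k) !) ≡ n !
  nCk*k!*[n∸k]!≡n! {n} {k} k≤n = begin
    (n C k) * (k ! * (n ∸ k) !)                    ≡⟨ cong (_* (k ! * (n ∸ k) !)) (nCk≡n!/k![n-k]! k≤n) ⟩
    n ! ℕ./ (k ! * (n ∸ k) !) * (k ! * (n ∸ k) !)  ≡⟨ ℕDM.m/n*n≡m (k![n∸k]!∣n! k≤n) ⟩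
    n !                                            ∎
    where
    open ≡-Reasoning
    instance _ = ℕP._!*_!≢0 k (n ∸ k)

  private
    nCj*[n∸j]Cl≡0 : ∀ n j l → n < j + l → (n C j) * ((n ∸ j) C l) ≡ 0
    nCj*[n∸j]Cl≡0 n j l n<j+l with j ℕP.≤? n
    ... | no  j≰n = cong (_* ((n ∸ j) C l)) (k>n⇒nCk≡0 (ℕP.≰⇒> j≰n))
    ... | yes j≤n = trans (cong ((n C j) *_) (k>n⇒nCk≡0 n∸j<l)) (ℕP.*-zeroʳ (n C j))
      where
      n∸j<l : n ∸ j < l
      n∸j<l = ℕP.+-cancelˡ-< j (n ∸ j) l (subst (_< j + l) (sym (ℕP.m+[n∸m]≡n j≤n)) n<j+l)

    nCj*[n∸j]Cl*j!*l!*[n∸j∸l]!≡n! : ∀ n j l → j + l ≤ n → (n C j) * ((n ∸ j) C l) * (j ! * l ! * (n ∸ j ∸ l) !) ≡ n !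
    nCj*[n∸j]Cl*j!*l!*[n∸j∸l]!≡n! n j l j+l≤n = begin
      (n C j) * ((n ∸ j) C l) * (j ! * l ! * (n ∸ j ∸ l) !)      ≡⟨ regroup (n C j) ((n ∸ j) C l) (j !) (l !) ((n ∸ j ∸ l) !) ⟩
      (n C j) * (j ! * (((n ∸ j) C l) * (l ! * (n ∸ j ∸ l) !)))  ≡⟨ cong (λ x → (n C j) * (j ! * x)) (nCk*k!*[n∸k]!≡n! l≤n∸j) ⟩
      (n C j) * (j ! * (n ∸ j) !)                                ≡⟨ nCk*k!*[n∸k]!≡n! (ℕP.m+n≤o⇒m≤o j j+l≤n) ⟩
      n !                                                        ∎
      where
      open ≡-Reasoning
      l≤n∸j : l ≤ n ∸ j
      l≤n∸j = subst (_≤ n ∸ j) (ℕP.m+n∸m≡n j l) (ℕP.∸-monoˡ-≤ j j+l≤n)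
      regroup : ∀ a b c d e → a * b * (c * d * e) ≡ a * (c * (b * (d * e)))
      regroup = ℕSolver.solve-∀

  nCj*[n∸j]Cl≡nCl*[n∸l]Cj : ∀ n j l → (n C j) * ((n ∸ j) C l) ≡ (n C l) * ((n ∸ l) C j)
  nCj*[n∸j]Cl≡nCl*[n∸l]Cj n j l with j + l ℕP.≤? n
  ... | no  j+l≰n = trans (nCj*[n∸j]Cl≡0 n j l n<j+l) (sym (nCj*[n∸j]Cl≡0 n l j (subst (n <_) (ℕP.+-comm j l) n<j+l)))
    where n<j+l = ℕP.≰⇒> j+l≰n
  ... | yes j+l≤n = ℕP.*-cancelʳ-≡ _ _ (j ! * l ! * (n ∸ j ∸ l) !) (begin
    (n C j) * ((n ∸ j) C l) * (j ! * l ! * (n ∸ j ∸ l) !)  ≡⟨ nCj*[n∸j]Cl*j!*l!*[n∸j∸l]!≡n! n j l j+l≤n ⟩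
    n !                                                    ≡⟨ sym (nCj*[n∸j]Cl*j!*l!*[n∸j∸l]!≡n! n l j l+j≤n) ⟩
    (n C l) * ((n ∸ l) C j) * (l ! * j ! * (n ∸ l ∸ j) !)  ≡⟨ cong ((n C l) * ((n ∸ l) C j) *_) (cong₂ (λ x y → x * y !) (ℕP.*-comm (l !) (j !)) n∸l∸j≡n∸j∸l) ⟩
    (n C l) * ((n ∸ l) C j) * (j ! * l ! * (n ∸ j ∸ l) !)  ∎)
    where
    open ≡-Reasoning
    instance _ = ℕP.m*n≢0 (j ! * l !) ((n ∸ j ∸ l) !) {{ℕP._!*_!≢0 j l}} {{ℕP._!≢0 (n ∸ j ∸ l)}}
    l+j≤n : l + j ≤ n
    l+j≤n = subst (_≤ n) (ℕP.+-comm j l) j+l≤n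
    n∸l∸j≡n∸j∸l : n ∸ l ∸ j ≡ n ∸ j ∸ l
    n∸l∸j≡n∸j∸l = trans (ℕP.∸-+-assoc n l j) (trans (cong (n ∸_) (ℕP.+-comm l j)) (sym (ℕP.∸-+-assoc n j l)))

  [1+n]Cn≡1+n : ∀ n → suc n C n ≡ suc n
  [1+n]Cn≡1+n n = trans (nCk≡nC[n∸k] (ℕP.n≤1+n n)) (trans (cong (suc n C_) (ℕP.m+n∸n≡m 1 n)) (nC1≡n (suc n)))

  2*[1+n]C2≡[1+n]*n : ∀ n → 2 * (suc n C 2) ≡ suc n * n
  2*[1+n]C2≡[1+n]*n zero    = refl
  2*[1+n]C2≡[1+n]*n (suc n) = begin
    2 * (suc (suc n) C 2)          ≡⟨ cong (2 *_) (sym (nCk+nC[k+1]≡[n+1]C[k+1] (suc n) 1)) ⟩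
    2 * (suc n C 1 + (suc n C 2))  ≡⟨ cong (λ x → 2 * (x + (suc n C 2))) (nC1≡n (suc n)) ⟩
    2 * (suc n + (suc n C 2))      ≡⟨ ℕP.*-distribˡ-+ 2 (suc n) (suc n C 2) ⟩
    2 * suc n + 2 * (suc n C 2)    ≡⟨ cong (λ x → 2 * suc n + x) (2*[1+n]C2≡[1+n]*n n) ⟩
    2 * suc n + suc n * n          ≡⟨ expand n ⟩
    suc (suc n) * suc n            ∎
    where
    open ≡-Reasoning
    expand : ∀ n → 2 * suc n + suc n * n ≡ suc (suc n) * suc n
    expand = ℕSolver.solve-∀

module _ where
  open import Data.Integer using (_+_; _*_; -_; _^_)

  ∑ : ℕ → (ℕ → ℤ) → ℤ
  ∑ zero    f = 0ℤ
  ∑ (suc n) f = ∑ n f + f n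

  infixl 10 ∑
  syntax ∑ n (λ i → e) = ∑[ i < n ] e

  ∑-cong : ∀ n {f g : ℕ → ℤ} → (∀ i → i ℕ.< n → f i ≡ g i) → ∑ n f ≡ ∑ n g
  ∑-cong zero    f≡g = refl
  ∑-cong (suc n) f≡g = cong₂ _+_ (∑-cong n (λ i i<n → f≡g i (ℕP.m<n⇒m<1+n i<n))) (f≡g n ℕP.≤-refl)

  ∑-zero : ∀ n → ∑[ i < n ] 0ℤ ≡ 0ℤ
  ∑-zero zero    = refl
  ∑-zero (suc n) = cong (_+ 0ℤ) (∑-zero n)

  ∑-const : ∀ n c → ∑[ i < n ] c ≡ + n * c
  ∑-const zero    c = refl
  ∑-const (suc n) c = begin
    ∑[ i < n ] c + c  ≡⟨ cong (_+ c) (∑-const n c) ⟩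
    + n * c + c       ≡⟨ cong (λ k → + n * c + k) (sym (ℤP.*-identityˡ c)) ⟩
    + n * c + 1ℤ * c  ≡⟨ sym (ℤP.*-distribʳ-+ c (+ n) 1ℤ) ⟩
    (+ n + 1ℤ) * c    ≡⟨ cong (_* c) (trans (sym (ℤP.pos-+ n 1)) (cong +_ (ℕP.+-comm n 1))) ⟩
    + suc n * c       ∎
    where open ≡-Reasoning

  ∑-distrib-+ : ∀ n (f g : ℕ → ℤ) → ∑[ i < n ] (f i + g i) ≡ ∑ n f + ∑ n g
  ∑-distrib-+ zero    f g = refl
  ∑-distrib-+ (suc n) f g = trans (cong (_+ (f n + g n)) (∑-distrib-+ n f g)) (interchange (∑ n f) (∑ n g) (f n) (g n))
    where
    interchange : ∀ a b c d → a + b + (c + d) ≡ a + c + (b + d)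
    interchange = solve-∀

  ∑-*ˡ : ∀ n c (f : ℕ → ℤ) → ∑[ i < n ] (c * f i) ≡ c * ∑ n f
  ∑-*ˡ zero    c f = sym (ℤP.*-zeroʳ c)
  ∑-*ˡ (suc n) c f = trans (cong (_+ c * f n) (∑-*ˡ n c f)) (sym (ℤP.*-distribˡ-+ c (∑ n f) (f n)))

  ∑-neg : ∀ n (f : ℕ → ℤ) → ∑[ i < n ] (- f i) ≡ - ∑ n f
  ∑-neg zero    f = refl
  ∑-neg (suc n) f = trans (cong (_+ - f n) (∑-neg n f)) (sym (ℤP.neg-distrib-+ (∑ n f) (f n)))

  ∑-suc : ∀ n (f : ℕ → ℤ) → ∑ (suc n) f ≡ f 0 + ∑[ i < n ] f (suc i)
  ∑-suc zero    f = ℤP.+-comm 0ℤ (f 0)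
  ∑-suc (suc n) f = trans (cong (_+ f (suc n)) (∑-suc n f)) (ℤP.+-assoc (f 0) (∑ n (f ∘ suc)) (f (suc n)))

  ∑-comm : ∀ m n (f : ℕ → ℕ → ℤ) → ∑[ i < m ] (∑[ j < n ] f i j) ≡ ∑[ j < n ] (∑[ i < m ] f i j)
  ∑-comm zero    n f = sym (∑-zero n)
  ∑-comm (suc m) n f = trans (cong (_+ ∑[ j < n ] f m j) (∑-comm m n f)) (sym (∑-distrib-+ n (λ j → ∑[ i < m ] f i j) (f m)))

  ∑-+ : ∀ m n (f : ℕ → ℤ) → ∑ (m ℕ.+ n) f ≡ ∑ m f + ∑[ i < n ] f (m ℕ.+ i)
  ∑-+ m zero    f = trans (cong (λ k → ∑ k f) (ℕP.+-identityʳ m)) (sym (ℤP.+-identityʳ (∑ m f)))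
  ∑-+ m (suc n) f = begin
    ∑ (m ℕ.+ suc n) f                             ≡⟨ cong (λ k → ∑ k f) (ℕP.+-suc m n) ⟩
    ∑ (m ℕ.+ n) f + f (m ℕ.+ n)                   ≡⟨ cong (_+ f (m ℕ.+ n)) (∑-+ m n f) ⟩
    ∑ m f + ∑[ i < n ] f (m ℕ.+ i) + f (m ℕ.+ n)  ≡⟨ ℤP.+-assoc (∑ m f) _ (f (m ℕ.+ n)) ⟩
    ∑ m f + ∑[ i < suc n ] f (m ℕ.+ i)            ∎
    where open ≡-Reasoning

  ∑-reverse : ∀ n (f : ℕ → ℤ) → ∑ n f ≡ ∑[ i < n ] f (n ℕ.∸ suc i)
  ∑-reverse zero    f = refl
  ∑-reverse (suc n) f = begin
    ∑ n f + f n                         ≡⟨ cong (_+ f n) (∑-reverse n f) ⟩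
    ∑[ i < n ] f (n ℕ.∸ suc i) + f n    ≡⟨ ℤP.+-comm _ (f n) ⟩
    f n + ∑[ i < n ] f (n ℕ.∸ suc i)    ≡⟨ sym (∑-suc n (λ i → f (suc n ℕ.∸ suc i))) ⟩
    ∑[ i < suc n ] f (suc n ℕ.∸ suc i)  ∎
    where open ≡-Reasoning

  ∑-extend : ∀ m n (f : ℕ → ℤ) → (∀ i → m ℕ.≤ i → f i ≡ 0ℤ) → ∑ (m ℕ.+ n) f ≡ ∑ m f
  ∑-extend m n f vanish = begin
    ∑ (m ℕ.+ n) f                   ≡⟨ ∑-+ m n f ⟩
    ∑ m f + ∑[ i < n ] f (m ℕ.+ i)  ≡⟨ cong (_+_ (∑ m f)) (trans (∑-cong n (λ i _ → vanish (m ℕ.+ i) (ℕP.m≤m+n m i))) (∑-zero n)) ⟩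
    ∑ m f + 0ℤ                      ≡⟨ ℤP.+-identityʳ (∑ m f) ⟩
    ∑ m f                           ∎
    where open ≡-Reasoning

  pos-^ : ∀ a e → + (a ℕ.^ e) ≡ (+ a) ^ e
  pos-^ a zero    = refl
  pos-^ a (suc e) = trans (ℤP.pos-* a (a ℕ.^ e)) (cong (+ a *_) (pos-^ a e))

  ^-distrib-* : ∀ a b n → (a * b) ^ n ≡ a ^ n * b ^ n
  ^-distrib-* a b zero    = refl
  ^-distrib-* a b (suc n) = trans (cong (a * b *_) (^-distrib-* a b n)) (interchange a b (a ^ n) (b ^ n))
    where
    interchange : ∀ a b c d → a * b * (c * d) ≡ a * c * (b * d)
    interchange = solve-∀

  +[1+a]≡+a+1 : ∀ a → + suc a ≡ + a + 1ℤ
  +[1+a]≡+a+1 a = trans (cong +_ (ℕP.+-comm 1 a)) (ℤP.pos-+ a 1)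

  binomial : ∀ n x → (x + 1ℤ) ^ n ≡ ∑[ l < suc n ] (+ (n C l) * x ^ l)
  binomial zero    x = refl
  binomial (suc n) x = sym (begin
    ∑[ l < suc (suc n) ] (+ (suc n C l) * x ^ l)
      ≡⟨ ∑-suc (suc n) _ ⟩
    1ℤ + ∑[ l < suc n ] (+ (suc n C suc l) * x ^ suc l)
      ≡⟨ cong (_+_ 1ℤ) (∑-cong (suc n) (λ l _ → pascal l)) ⟩
    1ℤ + ∑[ l < suc n ] (x * (+ (n C l) * x ^ l) + + (n C suc l) * x ^ suc l)
      ≡⟨ cong (_+_ 1ℤ) (∑-distrib-+ (suc n) _ _) ⟩
    1ℤ + (∑[ l < suc n ] (x * (+ (n C l) * x ^ l)) + shifted)
      ≡⟨ cong (λ s → 1ℤ + (s + shifted)) (∑-*ˡ (suc n) x _) ⟩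
    1ℤ + (x * expansion + shifted)
      ≡⟨ swap 1ℤ (x * expansion) shifted ⟩
    x * expansion + (1ℤ + shifted)
      ≡⟨ cong (_+_ (x * expansion)) 1+shifted≡expansion ⟩
    x * expansion + expansion
      ≡⟨ factor x expansion ⟩
    (x + 1ℤ) * expansion
      ≡⟨ cong ((x + 1ℤ) *_) (sym (binomial n x)) ⟩
    (x + 1ℤ) * (x + 1ℤ) ^ n
      ∎)
    where
    open ≡-Reasoning
    expansion shifted : ℤ
    expansion = ∑[ l < suc n ] (+ (n C l) * x ^ l)
    shifted   = ∑[ l < suc n ] (+ (n C suc l) * x ^ suc l)
    swap : ∀ a b c → a + (b + c) ≡ b + (a + c)
    swap = solve-∀
    factor : ∀ x s → x * s + s ≡ (x + 1ℤ) * s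
    factor = solve-∀
    pascal : ∀ l → + (suc n C suc l) * x ^ suc l ≡ x * (+ (n C l) * x ^ l) + + (n C suc l) * x ^ suc l
    pascal l = begin
      + (suc n C suc l) * x ^ suc l                        ≡⟨ cong (λ c → + c * x ^ suc l) (sym (nCk+nC[k+1]≡[n+1]C[k+1] n l)) ⟩
      + (n C l ℕ.+ n C suc l) * x ^ suc l                  ≡⟨ cong (_* x ^ suc l) (ℤP.pos-+ (n C l) (n C suc l)) ⟩
      (+ (n C l) + + (n C suc l)) * x ^ suc l              ≡⟨ distribute (+ (n C l)) (+ (n C suc l)) x (x ^ l) ⟩
      x * (+ (n C l) * x ^ l) + + (n C suc l) * x ^ suc l  ∎
      where
      distribute : ∀ a b x y → (a + b) * (x * y) ≡ x * (a * y) + b * (x * y)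
      distribute = solve-∀
    1+shifted≡expansion : 1ℤ + shifted ≡ expansion
    1+shifted≡expansion = begin
      1ℤ + shifted                              ≡⟨ sym (∑-suc (suc n) (λ l → + (n C l) * x ^ l)) ⟩
      ∑[ l < suc (suc n) ] (+ (n C l) * x ^ l)  ≡⟨ cong (λ c → expansion + + c * x ^ suc n) (k>n⇒nCk≡0 (ℕP.n<1+n n)) ⟩
      expansion + 0ℤ * x ^ suc n                ≡⟨ ℤP.+-identityʳ expansion ⟩
      expansion                                 ∎

  δ : ℕ → ℕ → ℤ
  δ m n = if ⌊ m ℕP.≟ n ⌋ then 1ℤ else 0ℤ

  δ-≢ : ∀ {m n} → m ≢ n → δ m n ≡ 0ℤ
  δ-≢ {m} {n} m≢n with m ℕP.≟ n
  ... | yes m≡n = ⊥-elim (m≢n m≡n)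
  ... | no  _   = refl

  powerSum : ℕ → ℕ → ℤ
  powerSum n e = ∑[ a < n ] ((+ a) ^ e)

  powerSum-expand : ∀ L k m J (c : ℕ → ℤ) (d : ℕ → ℕ) →
                    ∑[ a < L ] ((+ a) ^ k * ∑[ j < J ] (c j * (+ (a ℕ.* m)) ^ d j)) ≡ ∑[ j < J ] (c j * (+ m) ^ d j * powerSum L (k ℕ.+ d j))
  powerSum-expand L k m J c d = begin
    ∑[ a < L ] ((+ a) ^ k * ∑[ j < J ] (c j * (+ (a ℕ.* m)) ^ d j))
      ≡⟨ ∑-cong L (λ a _ → trans (sym (∑-*ˡ J ((+ a) ^ k) (λ j → c j * (+ (a ℕ.* m)) ^ d j))) (∑-cong J (λ j _ → regroup a j))) ⟩
    ∑[ a < L ] (∑[ j < J ] (c j * (+ m) ^ d j * (+ a) ^ (k ℕ.+ d j)))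
      ≡⟨ ∑-comm L J (λ a j → c j * (+ m) ^ d j * (+ a) ^ (k ℕ.+ d j)) ⟩
    ∑[ j < J ] (∑[ a < L ] (c j * (+ m) ^ d j * (+ a) ^ (k ℕ.+ d j)))
      ≡⟨ ∑-cong J (λ j _ → ∑-*ˡ L (c j * (+ m) ^ d j) (λ a → (+ a) ^ (k ℕ.+ d j))) ⟩
    ∑[ j < J ] (c j * (+ m) ^ d j * powerSum L (k ℕ.+ d j))
      ∎
    where
    open ≡-Reasoning
    regroup : ∀ a j → (+ a) ^ k * (c j * (+ (a ℕ.* m)) ^ d j) ≡ c j * (+ m) ^ d j * (+ a) ^ (k ℕ.+ d j)
    regroup a j = begin
      (+ a) ^ k * (c j * (+ (a ℕ.* m)) ^ d j)          ≡⟨ cong (λ x → (+ a) ^ k * (c j * x ^ d j)) (ℤP.pos-* a m) ⟩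
      (+ a) ^ k * (c j * (+ a * + m) ^ d j)            ≡⟨ cong (λ x → (+ a) ^ k * (c j * x)) (^-distrib-* (+ a) (+ m) (d j)) ⟩
      (+ a) ^ k * (c j * ((+ a) ^ d j * (+ m) ^ d j))  ≡⟨ rearrange ((+ a) ^ k) (c j) ((+ a) ^ d j) ((+ m) ^ d j) ⟩
      c j * (+ m) ^ d j * ((+ a) ^ k * (+ a) ^ d j)    ≡⟨ cong (c j * (+ m) ^ d j *_) (sym (ℤP.^-distribˡ-+-* (+ a) k (d j))) ⟩
      c j * (+ m) ^ d j * (+ a) ^ (k ℕ.+ d j)          ∎
      where
      rearrange : ∀ u c v w → u * (c * (v * w)) ≡ c * w * (u * v)
      rearrange = solve-∀

module _ where
  open import Defs using (B; bernList)

  weighted : ℕ → ℕ → List ℚ → List ℚ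
  weighted K j []       = []
  weighted K j (b ∷ bs) = (+ (K C j) ℚ./ 1) ℚ.* b ∷ weighted K (suc j) bs

  private
    weighted-unique : ∀ K {g : ℕ → List ℚ → List ℚ} → (∀ j → g j [] ≡ []) →
                      (∀ j b bs → g j (b ∷ bs) ≡ (+ (K C j) ℚ./ 1) ℚ.* b ∷ g (suc j) bs) →
                      ∀ j bs → g j bs ≡ weighted K j bs
    weighted-unique K g[] g∷ j []       = g[] j
    weighted-unique K {g} g[] g∷ j (b ∷ bs) = trans (g∷ j b bs) (cong (_ ∷_) (weighted-unique K {g} g[] g∷ (suc j) bs))

    -- Defs computes the weights with a local function that cannot be named; `bernoulliWeights k` is
    -- solved by unification with it once its index argument is abstracted by `with`. Peeling off two
    -- entries turns that index into the literal 2, which occurs nowhere else in the goal.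
    mutual
      bernoulliWeights : ℕ → ℕ → List ℚ → List ℚ
      bernoulliWeights k = _

      B-suc-reversed : ∀ k → let K = suc (length (bernList k)) in
                       B (suc k) ≡ ℚ.- ((+ 1 ℚ./ K) ℚ.* foldr ℚ._+_ 0ℚ (weighted K 0 (reverse (bernList k))))
      B-suc-reversed k with reverse (bernList k)
      ... | []           = refl
      ... | b₀ ∷ []      = refl
      ... | b₀ ∷ b₁ ∷ bs with 2 | foldr ℚ._+_ 0ℚ
      ... | j | sum = cong (λ ws → ℚ.- ((+ 1 ℚ./ K) ℚ.* (term 0 b₀ ℚ.+ (term 1 b₁ ℚ.+ sum ws))))
                           (weighted-unique K {bernoulliWeights k} (λ _ → refl) (λ _ _ _ → refl) j bs)
        where
        K = suc (length (bernList k))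
        term : ℕ → ℚ → ℚ
        term i b = (+ (K C i) ℚ./ 1) ℚ.* b

    length-bernList : ∀ k → length (bernList k) ≡ suc k
    length-bernList zero    = refl
    length-bernList (suc k) = cong suc (length-bernList k)

    reverse-bernList : ∀ k → reverse (bernList k) ≡ applyUpTo B (suc k)
    reverse-bernList zero    = refl
    reverse-bernList (suc k) = begin
      reverse (B (suc k) ∷ bernList k)   ≡⟨ ListP.unfold-reverse (B (suc k)) (bernList k) ⟩
      reverse (bernList k) ∷ʳ B (suc k)  ≡⟨ cong (_∷ʳ B (suc k)) (reverse-bernList k) ⟩
      applyUpTo B (suc k) ∷ʳ B (suc k)   ≡⟨ ListP.applyUpTo-∷ʳ B (suc k) ⟩
      applyUpTo B (suc (suc k))          ∎
      where open ≡-Reasoning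

  B-suc : ∀ k → B (suc k) ≡ ℚ.- ((+ 1 ℚ./ suc (suc k)) ℚ.* foldr ℚ._+_ 0ℚ (weighted (suc (suc k)) 0 (applyUpTo B (suc k))))
  B-suc k = trans (B-suc-reversed k)
    (cong₂ (λ n bs → ℚ.- ((+ 1 ℚ./ suc n) ℚ.* foldr ℚ._+_ 0ℚ (weighted (suc n) 0 bs))) (length-bernList k) (reverse-bernList k))

module Congruence (p : ℕ) where
  open import Data.Integer using (_+_; _*_; -_; _-_; _^_)
  open import Data.Integer.Divisibility.Signed using (_∣_; divides; ∣-refl; ∣m⇒∣-m; ∣m∣n⇒∣m+n; ∣m⇒∣m*n; ∣n⇒∣m*n; ∣ᵤ⇒∣)
  open import Relation.Binary.Bundles using (Setoid)
  import Relation.Binary.Reasoning.Setoid as SetoidReasoning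

  infix 4 _≈_
  record _≈_ (a b : ℤ) : Set where
    constructor mk≈
    field p∣a-b : + p ∣ a - b

  private
    p∣-resp : ∀ {a b} → a ≡ b → + p ∣ a → + p ∣ b
    p∣-resp refl p∣a = p∣a

  ≈-refl : ∀ {a} → a ≈ a
  ≈-refl {a} = mk≈ (p∣-resp (sym (ℤP.+-inverseʳ a)) (divides 0ℤ refl))

  ≡⇒≈ : ∀ {a b} → a ≡ b → a ≈ b
  ≡⇒≈ refl = ≈-refl

  ≈-sym : ∀ {a b} → a ≈ b → b ≈ a
  ≈-sym {a} {b} (mk≈ p∣a-b) = mk≈ (p∣-resp (negate a b) (∣m⇒∣-m p∣a-b))
    where
    negate : ∀ a b → - (a - b) ≡ b - a
    negate = solve-∀

  ≈-trans : ∀ {a b c} → a ≈ b → b ≈ c → a ≈ c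
  ≈-trans {a} {b} {c} (mk≈ p∣a-b) (mk≈ p∣b-c) = mk≈ (p∣-resp (telescope a b c) (∣m∣n⇒∣m+n p∣a-b p∣b-c))
    where
    telescope : ∀ a b c → (a - b) + (b - c) ≡ a - c
    telescope = solve-∀

  ≈-setoid : Setoid _ _
  ≈-setoid = record { Carrier = ℤ ; _≈_ = _≈_ ; isEquivalence = record { refl = ≈-refl ; sym = ≈-sym ; trans = ≈-trans } }

  module ≈-Reasoning = SetoidReasoning ≈-setoid

  +-cong : ∀ {a b c d} → a ≈ b → c ≈ d → a + c ≈ b + d
  +-cong {a} {b} {c} {d} (mk≈ p∣a-b) (mk≈ p∣c-d) = mk≈ (p∣-resp (regroup a b c d) (∣m∣n⇒∣m+n p∣a-b p∣c-d))
    where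
    regroup : ∀ a b c d → (a - b) + (c - d) ≡ (a + c) - (b + d)
    regroup = solve-∀

  +-congˡ : ∀ {a b} c → a ≈ b → c + a ≈ c + b
  +-congˡ c = +-cong (≈-refl {c})

  +-congʳ : ∀ {a b} c → a ≈ b → a + c ≈ b + c
  +-congʳ c a≈b = +-cong a≈b (≈-refl {c})

  neg-cong : ∀ {a b} → a ≈ b → - a ≈ - b
  neg-cong {a} {b} (mk≈ p∣a-b) = mk≈ (p∣-resp (negate a b) (∣m⇒∣-m p∣a-b))
    where
    negate : ∀ a b → - (a - b) ≡ - a - - b
    negate = solve-∀

  *-cong : ∀ {a b c d} → a ≈ b → c ≈ d → a * c ≈ b * d
  *-cong {a} {b} {c} {d} (mk≈ p∣a-b) (mk≈ p∣c-d) =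
    mk≈ (p∣-resp (regroup a b c d) (∣m∣n⇒∣m+n (∣m⇒∣m*n c p∣a-b) (∣n⇒∣m*n b p∣c-d)))
    where
    regroup : ∀ a b c d → (a - b) * c + b * (c - d) ≡ a * c - b * d
    regroup = solve-∀

  *-congˡ : ∀ {a b} c → a ≈ b → c * a ≈ c * b
  *-congˡ c = *-cong (≈-refl {c})

  *-congʳ : ∀ {a b} c → a ≈ b → a * c ≈ b * c
  *-congʳ c a≈b = *-cong a≈b (≈-refl {c})

  ^-cong : ∀ {a b} n → a ≈ b → a ^ n ≈ b ^ n
  ^-cong zero    a≈b = ≈-refl
  ^-cong (suc n) a≈b = *-cong a≈b (^-cong n a≈b)

  ∣⇒≈0 : ∀ {a} → + p ∣ a → a ≈ 0ℤ
  ∣⇒≈0 {a} p∣a = mk≈ (p∣-resp (sym (ℤP.+-identityʳ a)) p∣a)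

  ≈0⇒∣ : ∀ {a} → a ≈ 0ℤ → + p ∣ a
  ≈0⇒∣ {a} (mk≈ p∣a-0) = p∣-resp (ℤP.+-identityʳ a) p∣a-0

  p≈0 : + p ≈ 0ℤ
  p≈0 = ∣⇒≈0 ∣-refl

  x*p≈0 : ∀ x → x * + p ≈ 0ℤ
  x*p≈0 x = ∣⇒≈0 (divides x refl)

  p∣a⇒a^[1+e]≈0 : ∀ {a} e → p ℕD.∣ a → (+ a) ^ suc e ≈ 0ℤ
  p∣a⇒a^[1+e]≈0 {a} e p∣a = ≈-trans (*-congʳ ((+ a) ^ e) (∣⇒≈0 (∣ᵤ⇒∣ {+ p} {+ a} p∣a))) (≡⇒≈ (ℤP.*-zeroˡ ((+ a) ^ e)))

  p+i≈i : ∀ i → + (p ℕ.+ i) ≈ + i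
  p+i≈i i = ≈-trans (≡⇒≈ (ℤP.pos-+ p i)) (≈-trans (+-congʳ (+ i) p≈0) (≡⇒≈ (ℤP.+-identityˡ (+ i))))

  ∑-cong-≈ : ∀ n {f g : ℕ → ℤ} → (∀ i → i ℕ.< n → f i ≈ g i) → ∑ n f ≈ ∑ n g
  ∑-cong-≈ zero    f≈g = ≈-refl
  ∑-cong-≈ (suc n) f≈g = +-cong (∑-cong-≈ n (λ i i<n → f≈g i (ℕP.m<n⇒m<1+n i<n))) (f≈g n ℕP.≤-refl)

  ∑≈0 : ∀ n {f : ℕ → ℤ} → (∀ i → i ℕ.< n → f i ≈ 0ℤ) → ∑ n f ≈ 0ℤ
  ∑≈0 n f≈0 = ≈-trans (∑-cong-≈ n f≈0) (≡⇒≈ (∑-zero n))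

  ∑-single : ∀ n c {f : ℕ → ℤ} → c ℕ.< n → (∀ i → i ℕ.< n → i ≢ c → f i ≈ 0ℤ) → ∑ n f ≈ f c
  ∑-single (suc n) c {f} c<1+n others≈0 with c ℕP.≟ n
  ... | yes refl = ≈-trans (+-congʳ (f c) (∑≈0 n (λ i i<n → others≈0 i (ℕP.m<n⇒m<1+n i<n) (ℕP.<⇒≢ i<n))))
                           (≡⇒≈ (ℤP.+-identityˡ (f c)))
  ... | no  c≢n  = ≈-trans (+-cong (∑-single n c (ℕP.≤∧≢⇒< (ℕP.≤-pred c<1+n) c≢n) (λ i i<n → others≈0 i (ℕP.m<n⇒m<1+n i<n)))
                                   (others≈0 n ℕP.≤-refl (c≢n ∘ sym)))
                           (≡⇒≈ (ℤP.+-identityʳ (f c)))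

module PrimeModulus {p : ℕ} (prime : Prime p) where
  open Congruence p public
  open import Data.Integer using (_+_; _*_; -_; _-_; _^_)
  open import Data.Integer.Divisibility.Signed using (_∣_; divides; ∣ᵤ⇒∣; ∣⇒∣ᵤ; ∣m⇒∣m*n)
  import Data.Integer.DivMod as ℤDM
  open ≈-Reasoning

  instance
    p≢0 : ℕ.NonZero p
    p≢0 = prime⇒nonZero prime

  2≤p : 2 ℕ.≤ p
  2≤p = ℕ.nonTrivial⇒n>1 p {{prime⇒nonTrivial prime}}

  0<n<p⇒p∤n : ∀ {n} → 0 ℕ.< n → n ℕ.< p → ¬ p ℕD.∣ n
  0<n<p⇒p∤n 0<n n<p p∣n = ℕP.<⇒≱ n<p (ℕD.∣⇒≤ {{ℕ.>-nonZero 0<n}} p∣n)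

  ∤⇒∤ℤ : ∀ {n} → ¬ p ℕD.∣ n → ¬ + p ∣ + n
  ∤⇒∤ℤ p∤n p∣n = p∤n (∣⇒∣ᵤ p∣n)

  euclidsLemmaℤ : ∀ a b → + p ∣ a * b → + p ∣ a ⊎ + p ∣ b
  euclidsLemmaℤ a b p∣ab with euclidsLemma ℤ.∣ a ∣ ℤ.∣ b ∣ prime (subst (p ℕD.∣_) (ℤP.abs-* a b) (∣⇒∣ᵤ p∣ab))
  ... | inj₁ p∣a = inj₁ (∣ᵤ⇒∣ p∣a)
  ... | inj₂ p∣b = inj₂ (∣ᵤ⇒∣ p∣b)

  ∤-* : ∀ {a b} → ¬ + p ∣ a → ¬ + p ∣ b → ¬ + p ∣ a * b
  ∤-* {a} {b} p∤a p∤b p∣ab with euclidsLemmaℤ a b p∣ab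
  ... | inj₁ p∣a = p∤a p∣a
  ... | inj₂ p∣b = p∤b p∣b

  ∤-^ : ∀ {a} n → ¬ + p ∣ a → ¬ + p ∣ a ^ n
  ∤-^ zero    p∤a p∣1 = ℕ.nonTrivial⇒≢1 {{prime⇒nonTrivial prime}} (ℕD.∣1⇒≡1 (∣⇒∣ᵤ p∣1))
  ∤-^ (suc n) p∤a     = ∤-* p∤a (∤-^ n p∤a)

  p∣a*b^n⇒p∣a : ∀ {a b} n → ¬ + p ∣ b → + p ∣ a * b ^ n → + p ∣ a
  p∣a*b^n⇒p∣a {a} {b} n p∤b p∣ab^n with euclidsLemmaℤ a (b ^ n) p∣ab^n
  ... | inj₁ p∣a   = p∣a
  ... | inj₂ p∣b^n = ⊥-elim (∤-^ n p∤b p∣b^n)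

  *-cancelˡ-≈ : ∀ {a b} c → ¬ + p ∣ c → c * a ≈ c * b → a ≈ b
  *-cancelˡ-≈ {a} {b} c p∤c (mk≈ p∣ca-cb) with euclidsLemmaℤ c (a - b) (subst (+ p ∣_) (factor c a b) p∣ca-cb)
    where
    factor : ∀ c a b → c * a - c * b ≡ c * (a - b)
    factor = solve-∀
  ... | inj₁ p∣c   = ⊥-elim (p∤c p∣c)
  ... | inj₂ p∣a-b = mk≈ p∣a-b

  p∤m! : ∀ {m} → m ℕ.< p → ¬ p ℕD.∣ m !
  p∤m! {zero}  _   p∣1   = ℕ.nonTrivial⇒≢1 {{prime⇒nonTrivial prime}} (ℕD.∣1⇒≡1 p∣1)
  p∤m! {suc m} m<p p∣m! with euclidsLemma (suc m) (m !) prime p∣m!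
  ... | inj₁ p∣1+m = 0<n<p⇒p∤n (s≤s z≤n) m<p p∣1+m
  ... | inj₂ p∣m!′ = p∤m! (ℕP.<-trans (ℕP.n<1+n m) m<p) p∣m!′

  p∣pCk : ∀ {k} → 0 ℕ.< k → k ℕ.< p → p ℕD.∣ p C k
  p∣pCk {k} 0<k k<p with euclidsLemma (p C k) (k ! ℕ.* (p ℕ.∸ k) !) prime (subst (p ℕD.∣_) (sym (nCk*k!*[n∸k]!≡n! (ℕP.<⇒≤ k<p))) (n∣n! p))
    where
    n∣n! : ∀ n .{{_ : ℕ.NonZero n}} → n ℕD.∣ n !
    n∣n! (suc n) = ℕD.m∣m*n (n !)
  ... | inj₁ p∣pCk = p∣pCk
  ... | inj₂ p∣k![p∸k]! with euclidsLemma (k !) ((p ℕ.∸ k) !) prime p∣k![p∸k]!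
  ...   | inj₁ p∣k!     = ⊥-elim (p∤m! k<p p∣k!)
  ...   | inj₂ p∣[p∸k]! = ⊥-elim (p∤m! (ℕP.∸-monoʳ-< 0<k (ℕP.<⇒≤ k<p)) p∣[p∸k]!)

  fermat-ℕ : ∀ a → (+ a) ^ p ≈ + a
  fermat-ℕ zero    = ≡⇒≈ (trans (cong (0ℤ ^_) (sym (ℕP.suc-pred p))) (ℤP.*-zeroˡ (0ℤ ^ ℕ.pred p)))
  fermat-ℕ (suc a) = begin
    (+ suc a) ^ p               ≡⟨ cong (_^ p) (+[1+a]≡+a+1 a) ⟩
    (+ a + 1ℤ) ^ p              ≡⟨ binomial p (+ a) ⟩
    ∑ p term + term p           ≈⟨ +-congʳ (term p) (∑-single p 0 (ℕ.>-nonZero⁻¹ p) middle≈0) ⟩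
    1ℤ + + (p C p) * (+ a) ^ p  ≡⟨ cong (λ c → 1ℤ + + c * (+ a) ^ p) (nCn≡1 p) ⟩
    1ℤ + 1ℤ * (+ a) ^ p         ≡⟨ cong (_+_ 1ℤ) (ℤP.*-identityˡ ((+ a) ^ p)) ⟩
    1ℤ + (+ a) ^ p              ≈⟨ +-congˡ 1ℤ (fermat-ℕ a) ⟩
    1ℤ + + a                    ≡⟨ trans (ℤP.+-comm 1ℤ (+ a)) (sym (+[1+a]≡+a+1 a)) ⟩
    + suc a                     ∎
    where
    term : ℕ → ℤ
    term l = + (p C l) * (+ a) ^ l
    middle≈0 : ∀ l → l ℕ.< p → l ≢ 0 → term l ≈ 0ℤ
    middle≈0 zero    _   0≢0 = ⊥-elim (0≢0 refl)
    middle≈0 (suc l) l<p _   = ∣⇒≈0 (∣m⇒∣m*n {m = + (p C suc l)} ((+ a) ^ suc l) (∣ᵤ⇒∣ (p∣pCk (s≤s z≤n) l<p)))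

  fermat : ∀ x → x ^ p ≈ x
  fermat x = begin
    x ^ p      ≈⟨ ^-cong p x≈r ⟩
    (+ r) ^ p  ≈⟨ fermat-ℕ r ⟩
    + r        ≈⟨ ≈-sym x≈r ⟩
    x          ∎
    where
    r = x ℤDM.% + p
    x≈r : x ≈ + r
    x≈r = begin
      x                          ≡⟨ ℤDM.a≡a%n+[a/n]*n x (+ p) ⟩
      + r + (x ℤDM./ + p) * + p  ≈⟨ +-congˡ (+ r) (x*p≈0 (x ℤDM./ + p)) ⟩
      + r + 0ℤ                   ≡⟨ ℤP.+-identityʳ (+ r) ⟩
      + r                        ∎

  fermat-inverse : ∀ {x} → ¬ + p ∣ x → x * x ^ (p ℕ.∸ 2) ≈ 1ℤ
  fermat-inverse {x} p∤x = *-cancelˡ-≈ x p∤x (begin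
    x * (x * x ^ (p ℕ.∸ 2))  ≡⟨ cong (x ^_) (ℕP.m+[n∸m]≡n 2≤p) ⟩
    x ^ p                    ≈⟨ fermat x ⟩
    x                        ≡⟨ sym (ℤP.*-identityʳ x) ⟩
    x * 1ℤ                   ∎)

  ^-reduce : ∀ x e → x ^ (e ℕ.+ p) ≈ x ^ suc e
  ^-reduce x e = begin
    x ^ (e ℕ.+ p)  ≡⟨ ℤP.^-distribˡ-+-* x e p ⟩
    x ^ e * x ^ p  ≈⟨ *-congˡ (x ^ e) (fermat x) ⟩
    x ^ e * x      ≡⟨ ℤP.*-comm (x ^ e) x ⟩
    x ^ suc e      ∎

module Residue {p : ℕ} (prime : Prime p) where
  open PrimeModulus prime public
  open import Data.Integer using (_+_; _*_; -_; _-_; _^_)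
  open import Data.Integer.Divisibility.Signed using (_∣_; ∣⇒∣ᵤ; ∣ᵤ⇒∣)
  open import Defs using (_≡_[modℚ_]; sumFrom1; sumCop; coprimeTo; inv)
  open ≈-Reasoning

  Integral : ℚ → Set
  Integral x = ¬ p ℕD.∣ ↧ₙ x

  residue : ℚ → ℤ
  residue x = ↥ x * ↧ x ^ (p ℕ.∸ 2)

  infix 4 _↦_
  record _↦_ (x : ℚ) (t : ℤ) : Set where
    constructor mk↦
    field
      integral  : Integral x
      residue≈  : residue x ≈ t
  open _↦_ public

  ↦-respʳ : ∀ {x s t} → x ↦ s → s ≈ t → x ↦ t
  ↦-respʳ (mk↦ integral r≈s) s≈t = mk↦ integral (≈-trans r≈s s≈t)

  -- x = M / e with g the cancelled common factor; as ↧ x ^ (p ∸ 2) and e ^ (p ∸ 2) invert ↧ x and e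
  -- modulo p, both fractions give the same residue.
  fraction-↦ : ∀ x M e g → ↥ x * g ≡ M → ↧ x * g ≡ + e → ¬ p ℕD.∣ e → x ↦ M * (+ e) ^ (p ℕ.∸ 2)
  fraction-↦ x M e g ↥x*g≡M ↧x*g≡e p∤e = mk↦ p∤D N*D^k≈M*E^k
    where
    k = p ℕ.∸ 2
    N = ↥ x
    D = ↧ x
    E = + e
    p∤D : Integral x
    p∤D p∣D = p∤e (ℕD.∣-trans p∣D (ℕD.divides ℤ.∣ g ∣ (trans (cong ℤ.∣_∣ (sym ↧x*g≡e)) (trans (ℤP.abs-* D g) (ℕP.*-comm (↧ₙ x) ℤ.∣ g ∣)))))
    N*E≡M*D : N * E ≡ M * D
    N*E≡M*D = trans (cong (N *_) (sym ↧x*g≡e)) (trans (regroup N D g) (cong (_* D) ↥x*g≡M))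
      where
      regroup : ∀ a b c → a * (b * c) ≡ a * c * b
      regroup = solve-∀
    N*D^k≈M*E^k : N * D ^ k ≈ M * E ^ k
    N*D^k≈M*E^k = begin
      N * D ^ k                ≡⟨ sym (ℤP.*-identityʳ _) ⟩
      N * D ^ k * 1ℤ           ≈⟨ *-congˡ (N * D ^ k) (≈-sym (fermat-inverse (∤⇒∤ℤ p∤e))) ⟩
      N * D ^ k * (E * E ^ k)  ≡⟨ regroup₁ N (D ^ k) E (E ^ k) ⟩
      N * E * D ^ k * E ^ k    ≡⟨ cong (λ y → y * D ^ k * E ^ k) N*E≡M*D ⟩
      M * D * D ^ k * E ^ k    ≡⟨ regroup₂ M D (D ^ k) (E ^ k) ⟩
      D * D ^ k * (M * E ^ k)  ≈⟨ *-congʳ (M * E ^ k) (fermat-inverse (∤⇒∤ℤ p∤D)) ⟩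
      1ℤ * (M * E ^ k)         ≡⟨ ℤP.*-identityˡ _ ⟩
      M * E ^ k                ∎
      where
      regroup₁ : ∀ a b c d → a * b * (c * d) ≡ a * c * b * d
      regroup₁ = solve-∀
      regroup₂ : ∀ a b c d → a * b * c * d ≡ b * c * (a * d)
      regroup₂ = solve-∀

  /-↦ : ∀ i n .{{_ : ℕ.NonZero n}} → ¬ p ℕD.∣ n → i ℚ./ n ↦ i * (+ n) ^ (p ℕ.∸ 2)
  /-↦ i n = fraction-↦ (i ℚ./ n) i n _ (ℚP.↥-/ i n) (ℚP.↧-/ i n)

  fromℕ-↦ : ∀ c → + c ℚ./ 1 ↦ + c
  fromℕ-↦ c = ↦-respʳ (/-↦ (+ c) 1 p∤1) (≡⇒≈ (trans (cong (+ c *_) (ℤP.^-zeroˡ (p ℕ.∸ 2))) (ℤP.*-identityʳ (+ c))))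
    where
    p∤1 : ¬ p ℕD.∣ 1
    p∤1 p∣1 = ℕ.nonTrivial⇒≢1 {{prime⇒nonTrivial prime}} (ℕD.∣1⇒≡1 p∣1)

  0-↦ : 0ℚ ↦ 0ℤ
  0-↦ = fromℕ-↦ 0

  1-↦ : 1ℚ ↦ 1ℤ
  1-↦ = fromℕ-↦ 1

  private
    p∤↧*↧ : ∀ {x y} → Integral x → Integral y → ¬ p ℕD.∣ ↧ₙ x ℕ.* ↧ₙ y
    p∤↧*↧ {x} {y} p∤↧x p∤↧y p∣↧x↧y with euclidsLemma (↧ₙ x) (↧ₙ y) prime p∣↧x↧y
    ... | inj₁ p∣↧x = p∤↧x p∣↧x
    ... | inj₂ p∣↧y = p∤↧y p∣↧y

    ↧*↧≡ : ∀ x y → (+ (↧ₙ x ℕ.* ↧ₙ y)) ^ (p ℕ.∸ 2) ≡ ↧ x ^ (p ℕ.∸ 2) * ↧ y ^ (p ℕ.∸ 2)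
    ↧*↧≡ x y = trans (cong (_^ (p ℕ.∸ 2)) (ℤP.pos-* (↧ₙ x) (↧ₙ y))) (^-distrib-* (↧ x) (↧ y) (p ℕ.∸ 2))

  +-↦ : ∀ {x y s t} → x ↦ s → y ↦ t → x ℚ.+ y ↦ s + t
  +-↦ {x} {y} (mk↦ p∤b s≈) (mk↦ p∤d t≈) = ↦-respʳ sum↦ (≈-trans residue-+ (+-cong s≈ t≈))
    where
    k = p ℕ.∸ 2
    a = ↥ x
    b = ↧ x
    c = ↥ y
    d = ↧ y
    sum↦ : x ℚ.+ y ↦ (a * d + c * b) * (+ (↧ₙ x ℕ.* ↧ₙ y)) ^ k
    sum↦ = fraction-↦ (x ℚ.+ y) (a * d + c * b) (↧ₙ x ℕ.* ↧ₙ y) _ (ℚP.↥-+ x y) (trans (ℚP.↧-+ x y) (sym (ℤP.pos-* (↧ₙ x) (↧ₙ y)))) (p∤↧*↧ {x} {y} p∤b p∤d)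
    residue-+ : (a * d + c * b) * (+ (↧ₙ x ℕ.* ↧ₙ y)) ^ k ≈ a * b ^ k + c * d ^ k
    residue-+ = begin
      (a * d + c * b) * (+ (↧ₙ x ℕ.* ↧ₙ y)) ^ k          ≡⟨ cong ((a * d + c * b) *_) (↧*↧≡ x y) ⟩
      (a * d + c * b) * (b ^ k * d ^ k)                  ≡⟨ regroup a b c d (b ^ k) (d ^ k) ⟩
      a * b ^ k * (d * d ^ k) + c * d ^ k * (b * b ^ k)  ≈⟨ +-cong (*-congˡ (a * b ^ k) (fermat-inverse (∤⇒∤ℤ p∤d)))
                                                                 (*-congˡ (c * d ^ k) (fermat-inverse (∤⇒∤ℤ p∤b))) ⟩
      a * b ^ k * 1ℤ + c * d ^ k * 1ℤ  ≡⟨ cong₂ _+_ (ℤP.*-identityʳ (a * b ^ k)) (ℤP.*-identityʳ (c * d ^ k)) ⟩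
      a * b ^ k + c * d ^ k            ∎
      where
      regroup : ∀ a b c d u v → (a * d + c * b) * (u * v) ≡ a * u * (d * v) + c * v * (b * u)
      regroup = solve-∀

  *-↦ : ∀ {x y s t} → x ↦ s → y ↦ t → x ℚ.* y ↦ s * t
  *-↦ {x} {y} (mk↦ p∤b s≈) (mk↦ p∤d t≈) = ↦-respʳ product↦ (≈-trans (≡⇒≈ residue-*) (*-cong s≈ t≈))
    where
    k = p ℕ.∸ 2
    a = ↥ x
    b = ↧ x
    c = ↥ y
    d = ↧ y
    product↦ : x ℚ.* y ↦ a * c * (+ (↧ₙ x ℕ.* ↧ₙ y)) ^ k
    product↦ = fraction-↦ (x ℚ.* y) (a * c) (↧ₙ x ℕ.* ↧ₙ y) _ (ℚP.↥-* x y) (trans (ℚP.↧-* x y) (sym (ℤP.pos-* (↧ₙ x) (↧ₙ y)))) (p∤↧*↧ {x} {y} p∤b p∤d)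
    residue-* : a * c * (+ (↧ₙ x ℕ.* ↧ₙ y)) ^ k ≡ a * b ^ k * (c * d ^ k)
    residue-* = trans (cong (a * c *_) (↧*↧≡ x y)) (interchange a c (b ^ k) (d ^ k))
      where
      interchange : ∀ a c u v → a * c * (u * v) ≡ a * u * (c * v)
      interchange = solve-∀

  neg-↦ : ∀ {x t} → x ↦ t → ℚ.- x ↦ - t
  neg-↦ {x} (mk↦ p∤↧x r≈t) = mk↦ p∤↧-x (≈-trans (≡⇒≈ residue-neg) (neg-cong r≈t))
    where
    p∤↧-x : Integral (ℚ.- x)
    p∤↧-x = subst (λ n → ¬ p ℕD.∣ n) (sym (cong ℤ.∣_∣ (ℚP.↧-neg x))) p∤↧x
    residue-neg : residue (ℚ.- x) ≡ - residue x
    residue-neg = trans (cong₂ (λ n d → n * d ^ (p ℕ.∸ 2)) (ℚP.↥-neg x) (ℚP.↧-neg x)) (sym (ℤP.neg-distribˡ-* (↥ x) (↧ x ^ (p ℕ.∸ 2))))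

  ↦-unique⇒≡[modℚ] : ∀ {x y t} → x ↦ t → y ↦ t → x ≡ y [modℚ p ]
  ↦-unique⇒≡[modℚ] {x} {y} {t} x↦t y↦t = p∣numerator , integral x-y↦0
    where
    x-y↦0 : x ℚ.- y ↦ 0ℤ
    x-y↦0 = ↦-respʳ {x ℚ.- y} (+-↦ {x} {ℚ.- y} x↦t (neg-↦ {y} y↦t)) (≡⇒≈ (ℤP.+-inverseʳ t))
    p∣numerator : p ℕD.∣ ℤ.∣ ↥ (x ℚ.- y) ∣
    p∣numerator = ∣⇒∣ᵤ (p∣a*b^n⇒p∣a {↥ (x ℚ.- y)} {↧ (x ℚ.- y)} (p ℕ.∸ 2) (∤⇒∤ℤ (integral x-y↦0)) (≈0⇒∣ (residue≈ x-y↦0)))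

  inv-↦ : ∀ {i} e → ¬ p ℕD.∣ i → inv i e ↦ (+ i) ^ (e ℕ.* (p ℕ.∸ 2))
  inv-↦ {zero}  e p∤0 = ⊥-elim (p∤0 (p ℕD.∣0))
  inv-↦ {suc i} e p∤i = ↦-respʳ (/-↦ 1ℤ (suc i ℕ.^ e) p∤i^e) (≡⇒≈ 1*[1+i]^e^k≡[1+i]^[e*k])
    where
    instance _ = ℕ.>-nonZero (ℕP.m^n>0 (suc i) e)
    p∤i^e : ¬ p ℕD.∣ suc i ℕ.^ e
    p∤i^e p∣i^e = ∤-^ e (∤⇒∤ℤ p∤i) (subst (+ p ∣_) (pos-^ (suc i) e) (∣ᵤ⇒∣ p∣i^e))
    1*[1+i]^e^k≡[1+i]^[e*k] : 1ℤ * (+ (suc i ℕ.^ e)) ^ (p ℕ.∸ 2) ≡ (+ suc i) ^ (e ℕ.* (p ℕ.∸ 2))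
    1*[1+i]^e^k≡[1+i]^[e*k] = trans (ℤP.*-identityˡ _) (trans (cong (_^ (p ℕ.∸ 2)) (pos-^ (suc i) e)) (ℤP.^-*-assoc (+ suc i) e (p ℕ.∸ 2)))

  sumFrom1-↦ : ∀ n {f : ℕ → ℚ} {t : ℕ → ℤ} → (∀ i → i ℕ.< n → f (suc i) ↦ t (suc i)) → sumFrom1 n f ↦ ∑[ i < n ] t (suc i)
  sumFrom1-↦ zero    f↦t = 0-↦
  sumFrom1-↦ (suc n) {f} {t} f↦t = +-↦ (sumFrom1-↦ n {f} {t} (λ i i<n → f↦t i (ℕP.m<n⇒m<1+n i<n))) (f↦t n ℕP.≤-refl)

  private
    restricted-↦ : ∀ i {x t} → (¬ p ℕD.∣ i → x ↦ t) → (p ℕD.∣ i → t ≈ 0ℤ) → (if coprimeTo p i then x else 0ℚ) ↦ t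
    restricted-↦ i x↦t t≈0 with p ℕD.∣? i
    ... | yes p∣i = ↦-respʳ 0-↦ (≈-sym (t≈0 p∣i))
    ... | no  p∤i = x↦t p∤i

  -- Terms at multiples of p may be added since their residues vanish; this covers i = 0 as well.
  sumCop-↦ : ∀ n {f : ℕ → ℚ} {t : ℕ → ℤ} → (∀ i → ¬ p ℕD.∣ i → f i ↦ t i) → (∀ i → p ℕD.∣ i → t i ≈ 0ℤ) →
             sumCop p n f ↦ ∑[ i < suc n ] t i
  sumCop-↦ n {f} {t} f↦t t≈0 = ↦-respʳ (sumFrom1-↦ n {λ a → if coprimeTo p a then f a else 0ℚ} {t} (λ i _ → restricted-↦ (suc i) {f (suc i)} (f↦t (suc i)) (t≈0 (suc i)))) (begin
    ∑[ i < n ] t (suc i)        ≡⟨ sym (ℤP.+-identityˡ _) ⟩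
    0ℤ + ∑[ i < n ] t (suc i)   ≈⟨ +-congʳ (∑[ i < n ] t (suc i)) (≈-sym (t≈0 0 (p ℕD.∣0))) ⟩
    t 0 + ∑[ i < n ] t (suc i)  ≡⟨ sym (∑-suc n t) ⟩
    ∑[ i < suc n ] t i          ∎)

  weighted-↦ : ∀ K n j {f : ℕ → ℚ} {t : ℕ → ℤ} → (∀ i → i ℕ.< n → f i ↦ t i) →
               foldr ℚ._+_ 0ℚ (weighted K j (applyUpTo f n)) ↦ ∑[ i < n ] (+ (K C (j ℕ.+ i)) * t i)
  weighted-↦ K zero    j f↦t = 0-↦
  weighted-↦ K (suc n) j {f} {t} f↦t =
    ↦-respʳ (+-↦ (*-↦ (fromℕ-↦ (K C j)) (f↦t 0 (s≤s z≤n))) (weighted-↦ K n (suc j) (λ i i<n → f↦t (suc i) (s≤s i<n))))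
            (≡⇒≈ (sym (trans (∑-suc n _) (cong₂ _+_ head-index (∑-cong n (λ i _ → tail-index i))))))
    where
    head-index : + (K C (j ℕ.+ 0)) * t 0 ≡ + (K C j) * t 0
    head-index = cong (λ l → + (K C l) * t 0) (ℕP.+-identityʳ j)
    tail-index : ∀ i → + (K C (j ℕ.+ suc i)) * t (suc i) ≡ + (K C (suc j ℕ.+ i)) * t (suc i)
    tail-index i = cong (λ l → + (K C l) * t (suc i)) (ℕP.+-suc j i)

module _ (q : ℕ) (prime : Prime (3 ℕ.+ q)) where
  open Residue prime
  open import Data.Integer using (_+_; _*_; -_; _-_; _^_)
  open import Data.Integer.Divisibility.Signed using (_∣_; ∣-refl; ∣ᵤ⇒∣)
  open import Defs using (B; S; sumCop; inv; _≡_[modℚ_])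

  private
    p : ℕ
    p = 3 ℕ.+ q

  b : ℕ → ℤ
  b j = residue (B j)

  private
    B-suc-↦ : ∀ k → k ℕ.≤ q → (∀ j → j ℕ.≤ k → Integral (B j)) →
              B (suc k) ↦ - (1ℤ * (+ suc (suc k)) ^ suc q * ∑[ j < suc k ] (+ (suc (suc k) C j) * b j))
    B-suc-↦ k k≤q integral≤k rewrite B-suc k =
      neg-↦ (*-↦ (/-↦ 1ℤ (suc (suc k)) (0<n<p⇒p∤n (s≤s z≤n) (s≤s (s≤s (s≤s k≤q)))))
                  (weighted-↦ (suc (suc k)) (suc k) 0 {B} {b} (λ j j<1+k → mk↦ (integral≤k j (ℕP.≤-pred j<1+k)) ≈-refl)))

  B-integral : ∀ j → suc j ℕ.< p → Integral (B j)
  B-integral j 1+j<p = below j (ℕP.≤-pred (ℕP.≤-pred 1+j<p)) j ℕP.≤-refl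
    where
    below : ∀ k → k ℕ.≤ suc q → ∀ j → j ℕ.≤ k → Integral (B j)
    below zero    _      zero _ = integral 1-↦
    below (suc k) 1+k≤1+q j j≤1+k with j ℕP.≟ suc k
    ... | yes refl = integral (B-suc-↦ k (ℕP.≤-pred 1+k≤1+q) (below k (ℕP.m≤n⇒m≤1+n (ℕP.≤-pred 1+k≤1+q))))
    ... | no  j≢1+k = below k (ℕP.m≤n⇒m≤1+n (ℕP.≤-pred 1+k≤1+q)) j (ℕP.≤-pred (ℕP.≤∧≢⇒< j≤1+k j≢1+k))

  B-↦ : ∀ j → suc j ℕ.< p → B j ↦ b j
  B-↦ j 1+j<p = mk↦ (B-integral j 1+j<p) ≈-refl

  private
    bernoulli-recurrence : ∀ k → k ℕ.≤ q → ∑[ j < suc (suc k) ] (+ (suc (suc k) C j) * b j) ≈ 0ℤ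
    bernoulli-recurrence k k≤q = begin
      L + + (K C suc k) * b (suc k)         ≡⟨ cong (λ c → L + + c * b (suc k)) ([1+n]Cn≡1+n (suc k)) ⟩
      L + + K * b (suc k)                   ≈⟨ +-congˡ L (*-congˡ (+ K) (residue≈ B[1+k]↦)) ⟩
      L + + K * - (1ℤ * (+ K) ^ suc q * L)  ≡⟨ regroup L (+ K) ((+ K) ^ suc q) ⟩
      L - + K * (+ K) ^ suc q * L           ≈⟨ +-congˡ L (neg-cong (*-congʳ L (fermat-inverse (∤⇒∤ℤ p∤K)))) ⟩
      L - 1ℤ * L                            ≡⟨ cong (λ t → L - t) (ℤP.*-identityˡ L) ⟩
      L - L                                 ≡⟨ ℤP.+-inverseʳ L ⟩
      0ℤ                                    ∎
      where
      open ≈-Reasoning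
      K = suc (suc k)
      L = ∑[ j < suc k ] (+ (K C j) * b j)
      p∤K : ¬ p ℕD.∣ K
      p∤K = 0<n<p⇒p∤n (s≤s z≤n) (s≤s (s≤s (s≤s k≤q)))
      B[1+k]↦ : B (suc k) ↦ - (1ℤ * (+ K) ^ suc q * L)
      B[1+k]↦ = B-suc-↦ k k≤q (λ j j≤k → B-integral j (s≤s (s≤s (ℕP.≤-trans j≤k (ℕP.m≤n⇒m≤1+n k≤q)))))
      regroup : ∀ l k t → l + k * - (1ℤ * t * l) ≡ l - k * t * l
      regroup = solve-∀

  bernoulli-identity : ∀ N → N ℕ.< p → ∑[ j < N ] (+ (N C j) * b j) ≈ δ 1 N
  bernoulli-identity zero          _     = ≈-refl
  bernoulli-identity (suc zero)    _     = ≈-trans (≡⇒≈ (trans (ℤP.+-identityˡ _) (ℤP.*-identityˡ (b 0)))) (residue≈ 1-↦)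
  bernoulli-identity (suc (suc k)) 2+k<p = bernoulli-recurrence k (ℕP.≤-pred (ℕP.≤-pred (ℕP.≤-pred 2+k<p)))

  -- The residue of B_n(x) − B_n, the Bernoulli polynomial without its constant term.
  bernoulliPoly : ℕ → ℤ → ℤ
  bernoulliPoly n x = ∑[ j < n ] (+ (n C j) * b j * x ^ (n ℕ.∸ j))

  private
    n∸j≡1+n∸[1+j] : ∀ {n j} → j ℕ.< n → n ℕ.∸ j ≡ suc (n ℕ.∸ suc j)
    n∸j≡1+n∸[1+j] j<n = ℕP.+-∸-assoc 1 j<n

  bernoulliPoly-root : ∀ n {x} → x ≈ 0ℤ → bernoulliPoly n x ≈ 0ℤ
  bernoulliPoly-root n {x} x≈0 = ∑≈0 n (λ j j<n → begin
    + (n C j) * b j * x ^ (n ℕ.∸ j)             ≡⟨ cong (λ e → + (n C j) * b j * x ^ e) (n∸j≡1+n∸[1+j] j<n) ⟩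
    + (n C j) * b j * (x * x ^ (n ℕ.∸ suc j))   ≈⟨ *-congˡ (+ (n C j) * b j) (*-congʳ (x ^ (n ℕ.∸ suc j)) x≈0) ⟩
    + (n C j) * b j * (0ℤ * x ^ (n ℕ.∸ suc j))  ≡⟨ cong (+ (n C j) * b j *_) (ℤP.*-zeroˡ (x ^ (n ℕ.∸ suc j))) ⟩
    + (n C j) * b j * 0ℤ                        ≡⟨ ℤP.*-zeroʳ (+ (n C j) * b j) ⟩
    0ℤ                                          ∎)
    where open ≈-Reasoning

  private
    module BernoulliPolyShift (s : ℕ) (s≤q : s ℕ.≤ q) (x : ℤ) where
      N = suc (suc s)

      U : ℕ → ℤ
      U l = ∑[ j < N ] (+ ((N ℕ.∸ l) C j) * b j)

      expand : bernoulliPoly N (x + 1ℤ) ≡ ∑[ l < suc N ] (+ (N C l) * x ^ l * U l)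
      expand = begin
        bernoulliPoly N (x + 1ℤ)                  ≡⟨ ∑-cong N (λ j j<N → binomial-term j (ℕP.<⇒≤ j<N)) ⟩
        ∑[ j < N ] (∑[ l < suc N ] term j l)      ≡⟨ ∑-comm N (suc N) term ⟩
        ∑[ l < suc N ] (∑[ j < N ] term j l)      ≡⟨ ∑-cong (suc N) (λ l _ → trans (∑-cong N (λ j _ → swap j l)) (∑-*ˡ N (+ (N C l) * x ^ l) (λ j → + ((N ℕ.∸ l) C j) * b j))) ⟩
        ∑[ l < suc N ] (+ (N C l) * x ^ l * U l)  ∎
        where
        open ≡-Reasoning
        term : ℕ → ℕ → ℤ
        term j l = + (N C j) * b j * (+ ((N ℕ.∸ j) C l) * x ^ l)
        binomial-term : ∀ j → j ℕ.≤ N → + (N C j) * b j * (x + 1ℤ) ^ (N ℕ.∸ j) ≡ ∑[ l < suc N ] term j l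
        binomial-term j j≤N = begin
          + (N C j) * b j * (x + 1ℤ) ^ (N ℕ.∸ j)                                ≡⟨ cong (+ (N C j) * b j *_) (binomial (N ℕ.∸ j) x) ⟩
          + (N C j) * b j * ∑[ l < suc (N ℕ.∸ j) ] (+ ((N ℕ.∸ j) C l) * x ^ l)  ≡⟨ cong (+ (N C j) * b j *_) extend ⟩
          + (N C j) * b j * ∑[ l < suc N ] (+ ((N ℕ.∸ j) C l) * x ^ l)          ≡⟨ sym (∑-*ˡ (suc N) (+ (N C j) * b j) _) ⟩
          ∑[ l < suc N ] term j l                                               ∎
          where
          extend : ∑[ l < suc (N ℕ.∸ j) ] (+ ((N ℕ.∸ j) C l) * x ^ l) ≡ ∑[ l < suc N ] (+ ((N ℕ.∸ j) C l) * x ^ l)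
          extend = trans (sym (∑-extend (suc (N ℕ.∸ j)) j _ (λ l N∸j<l → trans (cong (λ c → + c * x ^ l) (k>n⇒nCk≡0 N∸j<l)) (ℤP.*-zeroˡ (x ^ l)))))
                         (cong (λ n → ∑[ l < suc n ] (+ ((N ℕ.∸ j) C l) * x ^ l)) (ℕP.m∸n+n≡m j≤N))
        swap : ∀ j l → term j l ≡ + (N C l) * x ^ l * (+ ((N ℕ.∸ l) C j) * b j)
        swap j l = begin
          + (N C j) * b j * (+ ((N ℕ.∸ j) C l) * x ^ l)  ≡⟨ regroup₁ (+ (N C j)) (b j) (+ ((N ℕ.∸ j) C l)) (x ^ l) ⟩
          + (N C j) * + ((N ℕ.∸ j) C l) * b j * x ^ l    ≡⟨ cong (λ c → c * b j * x ^ l) (sym (ℤP.pos-* (N C j) ((N ℕ.∸ j) C l))) ⟩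
          + ((N C j) ℕ.* ((N ℕ.∸ j) C l)) * b j * x ^ l  ≡⟨ cong (λ c → + c * b j * x ^ l) (nCj*[n∸j]Cl≡nCl*[n∸l]Cj N j l) ⟩
          + ((N C l) ℕ.* ((N ℕ.∸ l) C j)) * b j * x ^ l  ≡⟨ cong (λ c → c * b j * x ^ l) (ℤP.pos-* (N C l) ((N ℕ.∸ l) C j)) ⟩
          + (N C l) * + ((N ℕ.∸ l) C j) * b j * x ^ l    ≡⟨ regroup₂ (+ (N C l)) (b j) (+ ((N ℕ.∸ l) C j)) (x ^ l) ⟩
          + (N C l) * x ^ l * (+ ((N ℕ.∸ l) C j) * b j)  ∎
          where
          regroup₁ : ∀ a b c d → a * b * (c * d) ≡ a * c * b * d
          regroup₁ = solve-∀
          regroup₂ : ∀ a b c d → a * c * b * d ≡ a * d * (c * b)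
          regroup₂ = solve-∀

      U-zero : U 0 ≈ 0ℤ
      U-zero = bernoulli-identity N (s≤s (s≤s (s≤s s≤q)))

      U-suc : ∀ i → i ℕ.< N → U (suc i) ≈ b (N ℕ.∸ suc i) + δ 1 (N ℕ.∸ suc i)
      U-suc i i<N = begin
        ∑[ j < N ] (+ (M C j) * b j)                        ≡⟨ cong (λ n → ∑[ j < n ] (+ (M C j) * b j)) (sym (ℕP.m+[n∸m]≡n M<N)) ⟩
        ∑[ j < suc M ℕ.+ (N ℕ.∸ suc M) ] (+ (M C j) * b j)  ≡⟨ ∑-extend (suc M) (N ℕ.∸ suc M) _ (λ j M<j → trans (cong (λ c → + c * b j) (k>n⇒nCk≡0 M<j)) (ℤP.*-zeroˡ (b j))) ⟩
        ∑[ j < M ] (+ (M C j) * b j) + + (M C M) * b M      ≡⟨ cong (λ c → ∑[ j < M ] (+ (M C j) * b j) + + c * b M) (nCn≡1 M) ⟩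
        ∑[ j < M ] (+ (M C j) * b j) + 1ℤ * b M             ≈⟨ +-cong (bernoulli-identity M (ℕP.<-trans M<N (s≤s (s≤s (s≤s s≤q))))) (≡⇒≈ (ℤP.*-identityˡ (b M))) ⟩
        δ 1 M + b M                                         ≡⟨ ℤP.+-comm (δ 1 M) (b M) ⟩
        b M + δ 1 M                                         ∎
        where
        open ≈-Reasoning
        M = N ℕ.∸ suc i
        M<N : M ℕ.< N
        M<N = s≤s (ℕP.m∸n≤m (suc s) i)

      b-part : ∑[ i < N ] (+ (N C suc i) * x ^ suc i * b (N ℕ.∸ suc i)) ≡ bernoulliPoly N x
      b-part = sym (trans (∑-reverse N _) (∑-cong N reindex))
        where
        swap : ∀ a b c → a * b * c ≡ a * c * b
        swap = solve-∀
        reindex : ∀ i → i ℕ.< N → + (N C (N ℕ.∸ suc i)) * b (N ℕ.∸ suc i) * x ^ (N ℕ.∸ (N ℕ.∸ suc i))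
                                  ≡ + (N C suc i) * x ^ suc i * b (N ℕ.∸ suc i)
        reindex i i<N = trans (cong₂ (λ c e → + c * b (N ℕ.∸ suc i) * x ^ e) (sym (nCk≡nC[n∸k] i<N)) (ℕP.m∸[m∸n]≡n i<N))
                              (swap (+ (N C suc i)) (b (N ℕ.∸ suc i)) (x ^ suc i))

      δ-part : ∑[ i < N ] (+ (N C suc i) * x ^ suc i * δ 1 (N ℕ.∸ suc i)) ≈ + N * x ^ suc s
      δ-part = ≈-trans (∑-single N s (ℕP.m<n⇒m<1+n (ℕP.n<1+n s)) off-diagonal) (≡⇒≈ diagonal)
        where
        off-diagonal : ∀ i → i ℕ.< N → i ≢ s → + (N C suc i) * x ^ suc i * δ 1 (N ℕ.∸ suc i) ≈ 0ℤ
        off-diagonal i i<N i≢s = ≡⇒≈ (trans (cong (+ (N C suc i) * x ^ suc i *_) (δ-≢ 1≢N∸[1+i])) (ℤP.*-zeroʳ (+ (N C suc i) * x ^ suc i)))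
          where
          1≢N∸[1+i] : 1 ≢ N ℕ.∸ suc i
          1≢N∸[1+i] 1≡N∸[1+i] = i≢s (ℕP.suc-injective (ℕP.+-cancelˡ-≡ 1 _ _ (trans (cong (ℕ._+ suc i) 1≡N∸[1+i]) (ℕP.m∸n+n≡m i<N))))
        diagonal : + (N C suc s) * x ^ suc s * δ 1 (N ℕ.∸ suc s) ≡ + N * x ^ suc s
        diagonal = trans (cong₂ (λ c d → + c * x ^ suc s * δ 1 d) ([1+n]Cn≡1+n (suc s)) (ℕP.m+n∸n≡m 1 s)) (ℤP.*-identityʳ (+ N * x ^ suc s))

      shift : bernoulliPoly N (x + 1ℤ) ≈ bernoulliPoly N x + + N * x ^ suc s
      shift = begin
        bernoulliPoly N (x + 1ℤ)
          ≡⟨ expand ⟩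
        ∑[ l < suc N ] (+ (N C l) * x ^ l * U l)
          ≡⟨ ∑-suc N _ ⟩
        1ℤ * 1ℤ * U 0 + ∑[ i < N ] (+ (N C suc i) * x ^ suc i * U (suc i))
          ≈⟨ +-cong (*-congˡ (1ℤ * 1ℤ) U-zero) (∑-cong-≈ N (λ i i<N → *-congˡ (+ (N C suc i) * x ^ suc i) (U-suc i i<N))) ⟩
        1ℤ * 1ℤ * 0ℤ + ∑[ i < N ] (+ (N C suc i) * x ^ suc i * (b (N ℕ.∸ suc i) + δ 1 (N ℕ.∸ suc i)))
          ≡⟨ ℤP.+-identityˡ _ ⟩
        ∑[ i < N ] (+ (N C suc i) * x ^ suc i * (b (N ℕ.∸ suc i) + δ 1 (N ℕ.∸ suc i)))
          ≡⟨ ∑-cong N (λ i _ → ℤP.*-distribˡ-+ (+ (N C suc i) * x ^ suc i) _ _) ⟩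
        ∑[ i < N ] (+ (N C suc i) * x ^ suc i * b (N ℕ.∸ suc i) + + (N C suc i) * x ^ suc i * δ 1 (N ℕ.∸ suc i))
          ≡⟨ ∑-distrib-+ N _ _ ⟩
        ∑[ i < N ] (+ (N C suc i) * x ^ suc i * b (N ℕ.∸ suc i)) + ∑[ i < N ] (+ (N C suc i) * x ^ suc i * δ 1 (N ℕ.∸ suc i))
          ≈⟨ +-cong (≡⇒≈ b-part) δ-part ⟩
        bernoulliPoly N x + + N * x ^ suc s
          ∎
        where open ≈-Reasoning

  p∸1≈-1 : + suc (suc q) ≈ - 1ℤ
  p∸1≈-1 = mk≈ (subst (+ p ∣_) (trans (cong +_ (ℕP.+-comm 1 (suc (suc q)))) (ℤP.pos-+ (suc (suc q)) 1)) ∣-refl)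

  p∸2≈-2 : + suc q ≈ - + 2
  p∸2≈-2 = mk≈ (subst (+ p ∣_) (trans (cong +_ (ℕP.+-comm 2 (suc q))) (ℤP.pos-+ (suc q) 2)) ∣-refl)

  faulhaber : ∀ s → s ℕ.≤ q → ∀ k → + suc (suc s) * powerSum k (suc s) ≈ bernoulliPoly (suc (suc s)) (+ k)
  faulhaber s s≤q zero    = ≈-trans (≡⇒≈ (ℤP.*-zeroʳ (+ suc (suc s)))) (≈-sym (bernoulliPoly-root (suc (suc s)) ≈-refl))
  faulhaber s s≤q (suc k) = begin
    + N * (powerSum k (suc s) + (+ k) ^ suc s)      ≡⟨ ℤP.*-distribˡ-+ (+ N) (powerSum k (suc s)) ((+ k) ^ suc s) ⟩
    + N * powerSum k (suc s) + + N * (+ k) ^ suc s  ≈⟨ +-congʳ (+ N * (+ k) ^ suc s) (faulhaber s s≤q k) ⟩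
    bernoulliPoly N (+ k) + + N * (+ k) ^ suc s     ≈⟨ ≈-sym (BernoulliPolyShift.shift s s≤q (+ k)) ⟩
    bernoulliPoly N (+ k + 1ℤ)                      ≡⟨ cong (bernoulliPoly N) (sym (+[1+a]≡+a+1 k)) ⟩
    bernoulliPoly N (+ suc k)                       ∎
    where
    open ≈-Reasoning
    N = suc (suc s)

  powerSum-vanishes : ∀ s → s ℕ.≤ q → powerSum p (suc s) ≈ 0ℤ
  powerSum-vanishes s s≤q = *-cancelˡ-≈ (+ N) (∤⇒∤ℤ (0<n<p⇒p∤n (s≤s z≤n) (s≤s (s≤s (s≤s s≤q))))) (begin
    + N * powerSum p (suc s)  ≈⟨ faulhaber s s≤q p ⟩
    bernoulliPoly N (+ p)     ≈⟨ bernoulliPoly-root N p≈0 ⟩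
    0ℤ                        ≡⟨ sym (ℤP.*-zeroʳ (+ N)) ⟩
    + N * 0ℤ                  ∎)
    where
    open ≈-Reasoning
    N = suc (suc s)

  powerSum-p∸1 : powerSum p (suc (suc q)) ≈ - 1ℤ
  powerSum-p∸1 = begin
    powerSum p (suc (suc q))                             ≡⟨ ∑-suc (suc (suc q)) _ ⟩
    0ℤ + ∑[ i < suc (suc q) ] ((+ suc i) ^ suc (suc q))  ≡⟨ ℤP.+-identityˡ _ ⟩
    ∑[ i < suc (suc q) ] ((+ suc i) ^ suc (suc q))       ≈⟨ ∑-cong-≈ (suc (suc q)) (λ i i<p-1 → fermat-inverse (∤⇒∤ℤ (0<n<p⇒p∤n (s≤s z≤n) (s≤s i<p-1)))) ⟩
    ∑[ i < suc (suc q) ] 1ℤ                              ≡⟨ trans (∑-const (suc (suc q)) 1ℤ) (ℤP.*-identityʳ _) ⟩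
    + suc (suc q)                                        ≈⟨ p∸1≈-1 ⟩
    - 1ℤ                                                 ∎
    where open ≈-Reasoning

  powerSum-2[p∸2]+d : ∀ d → 1 ℕ.≤ d → d ℕ.< p → powerSum p (2 ℕ.* suc q ℕ.+ d) ≈ - δ 2 d
  powerSum-2[p∸2]+d 1 _ _ = begin
    powerSum p (2 ℕ.* suc q ℕ.+ 1)  ≡⟨ cong (powerSum p) (exponent q) ⟩
    powerSum p (q ℕ.+ p)            ≈⟨ ∑-cong-≈ p (λ a _ → ^-reduce (+ a) q) ⟩
    powerSum p (suc q)              ≈⟨ powerSum-vanishes q ℕP.≤-refl ⟩
    0ℤ                              ∎
    where
    open ≈-Reasoning
    exponent : ∀ q → 2 ℕ.* suc q ℕ.+ 1 ≡ q ℕ.+ (3 ℕ.+ q)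
    exponent = ℕSolver.solve-∀
  powerSum-2[p∸2]+d 2 _ _ = begin
    powerSum p (2 ℕ.* suc q ℕ.+ 2)  ≡⟨ cong (powerSum p) (exponent q) ⟩
    powerSum p (suc q ℕ.+ p)        ≈⟨ ∑-cong-≈ p (λ a _ → ^-reduce (+ a) (suc q)) ⟩
    powerSum p (suc (suc q))        ≈⟨ powerSum-p∸1 ⟩
    - 1ℤ                            ∎
    where
    open ≈-Reasoning
    exponent : ∀ q → 2 ℕ.* suc q ℕ.+ 2 ≡ suc q ℕ.+ (3 ℕ.+ q)
    exponent = ℕSolver.solve-∀
  powerSum-2[p∸2]+d (suc (suc (suc t))) _ 3+t<p = begin
    powerSum p (2 ℕ.* suc q ℕ.+ (3 ℕ.+ t))  ≡⟨ cong (powerSum p) (exponent₁ q t) ⟩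
    powerSum p ((t ℕ.+ suc (suc q)) ℕ.+ p)  ≈⟨ ∑-cong-≈ p (λ a _ → ^-reduce (+ a) (t ℕ.+ suc (suc q))) ⟩
    powerSum p (suc (t ℕ.+ suc (suc q)))    ≡⟨ cong (powerSum p) (exponent₂ q t) ⟩
    powerSum p (t ℕ.+ p)                    ≈⟨ ∑-cong-≈ p (λ a _ → ^-reduce (+ a) t) ⟩
    powerSum p (suc t)                      ≈⟨ powerSum-vanishes t (ℕP.<⇒≤ (ℕP.≤-pred (ℕP.≤-pred (ℕP.≤-pred 3+t<p)))) ⟩
    0ℤ                                      ∎
    where
    open ≈-Reasoning
    exponent₁ : ∀ q t → 2 ℕ.* suc q ℕ.+ (3 ℕ.+ t) ≡ (t ℕ.+ suc (suc q)) ℕ.+ (3 ℕ.+ q)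
    exponent₁ = ℕSolver.solve-∀
    exponent₂ : ∀ q t → suc (t ℕ.+ suc (suc q)) ≡ t ℕ.+ (3 ℕ.+ q)
    exponent₂ = ℕSolver.solve-∀


  powerSum-periodic : ∀ n e → powerSum (n ℕ.* p) e ≈ + n * powerSum p e
  powerSum-periodic zero    e = ≡⇒≈ (sym (ℤP.*-zeroˡ (powerSum p e)))
  powerSum-periodic (suc n) e = begin
    ∑ (p ℕ.+ n ℕ.* p) f                   ≡⟨ ∑-+ p (n ℕ.* p) f ⟩
    ∑ p f + ∑[ i < n ℕ.* p ] f (p ℕ.+ i)  ≈⟨ +-congˡ (∑ p f) (∑-cong-≈ (n ℕ.* p) (λ i _ → ^-cong e (p+i≈i i))) ⟩
    ∑ p f + ∑ (n ℕ.* p) f                 ≈⟨ +-congˡ (∑ p f) (powerSum-periodic n e) ⟩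
    ∑ p f + + n * ∑ p f                   ≡⟨ factor (∑ p f) (+ n) ⟩
    (+ n + 1ℤ) * ∑ p f                    ≡⟨ cong (_* ∑ p f) (sym (+[1+a]≡+a+1 n)) ⟩
    + suc n * ∑ p f                       ∎
    where
    open ≈-Reasoning
    f : ℕ → ℤ
    f a = (+ a) ^ e
    factor : ∀ s n → s + n * s ≡ (n + 1ℤ) * s
    factor = solve-∀

  [p∸1]C[p∸3]≈1 : + (suc (suc q) C q) ≈ 1ℤ
  [p∸1]C[p∸3]≈1 = *-cancelˡ-≈ (+ 2) (∤⇒∤ℤ (0<n<p⇒p∤n (s≤s z≤n) (s≤s (s≤s (s≤s z≤n))))) (begin
    + 2 * + (suc (suc q) C q)    ≡⟨ cong (λ c → + 2 * + c) (trans (nCk≡nC[n∸k] (ℕP.m≤n+m q 2)) (cong (suc (suc q) C_) (ℕP.m+n∸n≡m 2 q))) ⟩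
    + 2 * + (suc (suc q) C 2)    ≡⟨ sym (ℤP.pos-* 2 (suc (suc q) C 2)) ⟩
    + (2 ℕ.* (suc (suc q) C 2))  ≡⟨ cong +_ (2*[1+n]C2≡[1+n]*n (suc q)) ⟩
    + (suc (suc q) ℕ.* suc q)    ≡⟨ ℤP.pos-* (suc (suc q)) (suc q) ⟩
    + suc (suc q) * + suc q      ≈⟨ *-cong p∸1≈-1 p∸2≈-2 ⟩
    - 1ℤ * - + 2                 ≡⟨⟩
    + 2 * 1ℤ                     ∎)
    where open ≈-Reasoning

  harmonic-↦ : ∀ n → sumCop p n (λ i → inv i 1) ↦ powerSum (suc n) (suc q)
  harmonic-↦ n = sumCop-↦ n {λ i → inv i 1} {λ i → (+ i) ^ suc q}
    (λ i p∤i → ↦-respʳ (inv-↦ 1 p∤i) (≡⇒≈ (cong ((+ i) ^_) (ℕP.*-identityˡ (suc q)))))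
    (λ i p∣i → p∣a⇒a^[1+e]≈0 q p∣i)

  powerSum-p∸2≈-bernoulliPoly : ∀ n → powerSum n (suc q) ≈ - bernoulliPoly (suc (suc q)) (+ n)
  powerSum-p∸2≈-bernoulliPoly n = begin
    H                                             ≡⟨ split (+ suc (suc q)) H ⟩
    (+ suc (suc q) + 1ℤ) * H - + suc (suc q) * H  ≡⟨ cong (λ c → c * H - + suc (suc q) * H) (sym (+[1+a]≡+a+1 (suc (suc q)))) ⟩
    + p * H - + suc (suc q) * H                   ≈⟨ +-cong (≈-trans (≡⇒≈ (ℤP.*-comm (+ p) H)) (x*p≈0 H)) (neg-cong (faulhaber q ℕP.≤-refl n)) ⟩
    0ℤ - bernoulliPoly (suc (suc q)) (+ n)        ≡⟨ ℤP.+-identityˡ _ ⟩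
    - bernoulliPoly (suc (suc q)) (+ n)           ∎
    where
    open ≈-Reasoning
    H = powerSum n (suc q)
    split : ∀ c h → h ≡ (c + 1ℤ) * h - c * h
    split = solve-∀

  S-↦ : ∀ m′ n → S (suc m′) (suc n) p ↦ ∑[ a < suc n ] ((+ a) ^ (2 ℕ.* suc q) * powerSum (a ℕ.* suc m′) (suc q))
  S-↦ m′ n = sumCop-↦ n {λ a → inv a 2 ℚ.* sumCop p (a ℕ.* m ℕ.∸ 1) (λ i → inv i 1)} {t} term↦ term≈0
    where
    m = suc m′
    t : ℕ → ℤ
    t a = (+ a) ^ (2 ℕ.* suc q) * powerSum (a ℕ.* m) (suc q)
    term↦ : ∀ a → ¬ p ℕD.∣ a → inv a 2 ℚ.* sumCop p (a ℕ.* m ℕ.∸ 1) (λ i → inv i 1) ↦ t a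
    term↦ zero    p∤0 = ⊥-elim (p∤0 (p ℕD.∣0))
    term↦ (suc a) p∤a = *-↦ (inv-↦ 2 p∤a) (harmonic-↦ (suc a ℕ.* m ℕ.∸ 1))
    term≈0 : ∀ a → p ℕD.∣ a → t a ≈ 0ℤ
    term≈0 a p∣a = ≈-trans (*-congʳ (powerSum (a ℕ.* m) (suc q)) (p∣a⇒a^[1+e]≈0 (q ℕ.+ 1 ℕ.* suc q) p∣a)) (≡⇒≈ (ℤP.*-zeroˡ (powerSum (a ℕ.* m) (suc q))))

  weighted-harmonic-sum : ∀ n m → ∑[ a < n ℕ.* p ] ((+ a) ^ (2 ℕ.* suc q) * powerSum (a ℕ.* m) (suc q)) ≈ + (n ℕ.* m ℕ.^ 2) * b q
  weighted-harmonic-sum n m = begin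
    ∑[ a < L ] ((+ a) ^ k₂ * powerSum (a ℕ.* m) (suc q))
      ≈⟨ ∑-cong-≈ L (λ a _ → *-congˡ ((+ a) ^ k₂) (powerSum-p∸2≈-bernoulliPoly (a ℕ.* m))) ⟩
    ∑[ a < L ] ((+ a) ^ k₂ * - bernoulliPoly N (+ (a ℕ.* m)))
      ≡⟨ trans (∑-cong L (λ a _ → sym (ℤP.neg-distribʳ-* ((+ a) ^ k₂) (bernoulliPoly N (+ (a ℕ.* m)))))) (∑-neg L _) ⟩
    - ∑[ a < L ] ((+ a) ^ k₂ * bernoulliPoly N (+ (a ℕ.* m)))
      ≡⟨ cong -_ (powerSum-expand L k₂ m N c d) ⟩
    - ∑[ j < N ] (c j * (+ m) ^ d j * powerSum L (k₂ ℕ.+ d j))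
      ≈⟨ neg-cong (∑-single N q (ℕP.m<n⇒m<1+n (ℕP.n<1+n q)) off-diagonal) ⟩
    - (c q * (+ m) ^ d q * powerSum L (k₂ ℕ.+ d q))
      ≡⟨ cong (λ e → - (c q * (+ m) ^ e * powerSum L (k₂ ℕ.+ e))) (ℕP.m+n∸n≡m 2 q) ⟩
    - (c q * (+ m) ^ 2 * powerSum L (k₂ ℕ.+ 2))
      ≈⟨ neg-cong (*-congˡ (c q * (+ m) ^ 2) (powerSum-n*p 2 (s≤s z≤n) (s≤s (s≤s (s≤s z≤n))))) ⟩
    - (c q * (+ m) ^ 2 * (+ n * - δ 2 2))
      ≡⟨ regroup (+ (N C q)) (b q) ((+ m) ^ 2) (+ n) ⟩
    + (N C q) * (+ n * (+ m) ^ 2 * b q)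
      ≈⟨ *-congʳ (+ n * (+ m) ^ 2 * b q) [p∸1]C[p∸3]≈1 ⟩
    1ℤ * (+ n * (+ m) ^ 2 * b q)
      ≡⟨ trans (ℤP.*-identityˡ _) (cong (_* b q) (sym (trans (ℤP.pos-* n (m ℕ.^ 2)) (cong (+ n *_) (pos-^ m 2))))) ⟩
    + (n ℕ.* m ℕ.^ 2) * b q
      ∎
    where
    open ≈-Reasoning
    L = n ℕ.* p
    N = suc (suc q)
    k₂ = 2 ℕ.* suc q
    c : ℕ → ℤ
    c j = + (N C j) * b j
    d : ℕ → ℕ
    d j = N ℕ.∸ j
    powerSum-n*p : ∀ e → 1 ℕ.≤ e → e ℕ.< p → powerSum L (k₂ ℕ.+ e) ≈ + n * - δ 2 e
    powerSum-n*p e 1≤e e<p = ≈-trans (powerSum-periodic n (k₂ ℕ.+ e)) (*-congˡ (+ n) (powerSum-2[p∸2]+d e 1≤e e<p))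
    off-diagonal : ∀ j → j ℕ.< N → j ≢ q → c j * (+ m) ^ d j * powerSum L (k₂ ℕ.+ d j) ≈ 0ℤ
    off-diagonal j j<N j≢q = begin
      c j * (+ m) ^ d j * powerSum L (k₂ ℕ.+ d j)  ≈⟨ *-congˡ (c j * (+ m) ^ d j) (powerSum-n*p (d j) 1≤d d<p) ⟩
      c j * (+ m) ^ d j * (+ n * - δ 2 (d j))      ≡⟨ cong (λ x → c j * (+ m) ^ d j * (+ n * - x)) (δ-≢ 2≢d) ⟩
      c j * (+ m) ^ d j * (+ n * 0ℤ)               ≡⟨ cong (c j * (+ m) ^ d j *_) (ℤP.*-zeroʳ (+ n)) ⟩
      c j * (+ m) ^ d j * 0ℤ                       ≡⟨ ℤP.*-zeroʳ (c j * (+ m) ^ d j) ⟩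
      0ℤ                                           ∎
      where
      1≤d : 1 ℕ.≤ d j
      1≤d = subst (1 ℕ.≤_) (sym (n∸j≡1+n∸[1+j] j<N)) (s≤s z≤n)
      d<p : d j ℕ.< p
      d<p = s≤s (ℕP.m∸n≤m N j)
      2≢d : 2 ≢ d j
      2≢d 2≡d = j≢q (ℕP.+-cancelˡ-≡ 2 j q (trans (cong (ℕ._+ j) 2≡d) (ℕP.m∸n+n≡m (ℕP.<⇒≤ j<N))))
    regroup : ∀ C b M n → - (C * b * M * (n * - 1ℤ)) ≡ C * (n * M * b)
    regroup = solve-∀

  S[m,np]≡nm²B : ∀ n′ m′ → let n = suc n′; m = suc m′ in
                 S m (n ℕ.* p) p ≡ (+ (n ℕ.* m ℕ.^ 2) ℚ./ 1) ℚ.* B q [modℚ p ]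
  S[m,np]≡nm²B n′ m′ = ↦-unique⇒≡[modℚ]
    (↦-respʳ (S-↦ m′ (suc n′ ℕ.* p ℕ.∸ 1)) (weighted-harmonic-sum (suc n′) (suc m′)))
    (*-↦ (fromℕ-↦ (suc n′ ℕ.* suc m′ ℕ.^ 2)) (B-↦ q (ℕP.m<n⇒m<1+n (ℕP.n<1+n (suc q)))))

open import Defs
open import Data.Nat using (ℕ; _*_; _∸_; _^_; NonZero)
open import Data.Nat.Divisibility using (_∣_)
open import Data.Nat.Primality using (Prime)
open import Data.Integer using (+_)
open import Data.Rational using (_/_)
open import Relation.Nullary using (¬_)
import Data.Rational as ℚ

lemma2p2 : (p n m : ℕ) → Prime p → ¬ (2 ∣ p) → .{{_ : NonZero n}} → .{{_ : NonZero m}}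
    → ¬ (p ∣ n) → ¬ (p ∣ m)
    → S m (n * p) p ≡ ((+ (n * m ^ 2)) / 1) ℚ.* B (p ∸ 3) [modℚ p ]
lemma2p2 0                   _        _        p-prime _   _ _ = ⊥-elim (¬prime[0] p-prime)
lemma2p2 1                   _        _        p-prime _   _ _ = ⊥-elim (¬prime[1] p-prime)
lemma2p2 2                   _        _        _       2∤2 _ _ = ⊥-elim (2∤2 ℕD.∣-refl)
lemma2p2 (suc (suc (suc q))) zero     _        _       _   _ _ = ⊥-elim (ℕ.≢-nonZero⁻¹ 0 refl)
lemma2p2 (suc (suc (suc q))) (suc n′) zero     _       _   _ _ = ⊥-elim (ℕ.≢-nonZero⁻¹ 0 refl)
lemma2p2 (suc (suc (suc q))) (suc n′) (suc m′) p-prime _   _ _ = S[m,np]≡nm²B q p-prime n′ m′
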